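{- Let $G=(V,E)$ be a connected graph whose number of vertices is divisible by $4$. Let $\{A,B\}$ be any bisection of $V$ and let $\mathcal{C}=\{A_1,A_2,B_1,B_2\}$ be an organized partition of $\{A,B\}$, with associated value $D_{\mathcal{C}}$. If $D_{\mathcal{C}}<0$, then $\{A,B\}$ is not a minimum cut. If $D_{\mathcal{C}}>0$, then $\{A,B\}$ is not a maximum cut.
   Context: For $X,Y\subseteq V$, $E(X,Y)$ denotes the number of edges of $G$ with one endpoint in $X$ and the other in $Y$. A cut (bisection) is a partition $\{A,B\}$ of $V$ with $|A|=|B|$. It is a minimum cut if $E(A,B)$ is minimum among all bisections, and a maximum cut if $E(A,B)$ is maximum among all bisections. For a bisection $\{A,B\}$, define $$D_{\mathcal{C}}=\min\big\{E(\bar A_1,\bar A_2)+E(\bar B_1,\bar B_2)-E(\bar A_1,\bar B_1)-E(\bar A_2,\bar B_2)\big\},$$ the minimum taken over all decompositions $A=\bar A_1\cup \bar A_2$, $B=\bar B_1\cup\bar B_2$ into disjoint sets with $|\bar A_1|=|\bar A_2|$ and $|\bar B_1|=|\bar B_2|$. Any decomposition $\mathcal{C}=\{A_1,A_2,B_1,B_2\}$ attaining this minimum is called an organized partition of $\{A,B\}$. -}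

module Defs where

open import Data.Bool using (Bool; true; false; _∧_; if_then_else_)
open import Data.Nat using (ℕ)
open import Data.Nat.Divisibility using (_∣_)
open import Data.Fin using (Fin)
open import Data.Fin.Subset using (Subset; _∈_; _∩_; _∪_; ∁; ∣_∣; ⊥)
open import Data.Fin.Subset.Properties using (_∈?_)
open import Data.List using (List; map; allFin)
open import Data.Nat.ListAction using (sum)
open import Data.Integer using (ℤ; +_; _-_; _≤_)
open import Data.Product using (_×_)
open import Relation.Nullary using (¬_; does)
open import Relation.Binary.PropositionalEquality using (_≡_)

record Graph (n : ℕ) : Set where
  field
    adj     : Fin n → Fin n → Bool
    symm    : ∀ u v → adj u v ≡ adj v u
    irrefl  : ∀ u → adj u u ≡ false
open Graph public

data Reach {n : ℕ} (G : Graph n) : Fin n → Fin n → Set where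
  here : ∀ {u} → Reach G u u
  step : ∀ {u w v} → adj G u w ≡ true → Reach G w v → Reach G u v

Connected : ∀ {n} → Graph n → Set
Connected {n} G = (u v : Fin n) → Reach G u v

-- E(X,Y): number of pairs (x,y) with x ∈ X, y ∈ Y, xy an edge.
-- For disjoint X, Y this is exactly the number of edges with one end in X and the other in Y.
E : ∀ {n} → Graph n → Subset n → Subset n → ℕ
E {n} G X Y =
  sum (map (λ x → sum (map (λ y →
        if does (x ∈? X) ∧ does (y ∈? Y) ∧ adj G x y then 1 else 0)
      (allFin n))) (allFin n))

IsBisection : ∀ {n} → Subset n → Set
IsBisection A = ∣ A ∣ ≡ ∣ ∁ A ∣

Cut : ∀ {n} → Graph n → Subset n → ℕ
Cut G A = E G A (∁ A)

IsMinCut : ∀ {n} → Graph n → Subset n → Set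
IsMinCut {n} G A = IsBisection A × ((A' : Subset n) → IsBisection A' → Cut G A Data.Nat.≤ Cut G A')

IsMaxCut : ∀ {n} → Graph n → Subset n → Set
IsMaxCut {n} G A = IsBisection A × ((A' : Subset n) → IsBisection A' → Cut G A' Data.Nat.≤ Cut G A)

IsHalving : ∀ {n} → Subset n → Subset n → Subset n → Set
IsHalving S S₁ S₂ = (S₁ ∩ S₂ ≡ ⊥) × (S₁ ∪ S₂ ≡ S) × (∣ S₁ ∣ ≡ ∣ S₂ ∣)

IsDecomposition : ∀ {n} → Subset n → Subset n → Subset n → Subset n → Subset n → Set
IsDecomposition A A₁ A₂ B₁ B₂ = IsHalving A A₁ A₂ × IsHalving (∁ A) B₁ B₂

DVal : ∀ {n} → Graph n → Subset n → Subset n → Subset n → Subset n → ℤ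
DVal G A₁ A₂ B₁ B₂ =
  (+ (E G A₁ A₂) Data.Integer.+ + (E G B₁ B₂)) - (+ (E G A₁ B₁) Data.Integer.+ + (E G A₂ B₂))

IsOrganized : ∀ {n} → Graph n → Subset n → Subset n → Subset n → Subset n → Subset n → Set
IsOrganized {n} G A A₁ A₂ B₁ B₂ =
  IsDecomposition A A₁ A₂ B₁ B₂ ×
  ((A₁' A₂' B₁' B₂' : Subset n) → IsDecomposition A A₁' A₂' B₁' B₂' →
     DVal G A₁ A₂ B₁ B₂ ≤ DVal G A₁' A₂' B₁' B₂')

module Submission where

-- Exchanging A₂ and B₁ gives the bisection
-- A' = A₁ ∪ B₁ (with ∁A' = A₂ ∪ B₂).  Expanding both cuts by bilinearity of E,
--   Cut A  = E(A₁,B₁) + E(A₁,B₂) + E(A₂,B₁) + E(A₂,B₂)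
--   Cut A' = E(A₁,A₂) + E(A₁,B₂) + E(B₁,A₂) + E(B₁,B₂),
-- and by symmetry of E the two middle terms agree, so the exchange identity
--   Cut A + (E(A₁,A₂) + E(B₁,B₂)) = Cut A' + (E(A₁,B₁) + E(A₂,B₂))
-- holds, i.e. Cut A' − Cut A = D.  Hence D < 0 exhibits a strictly smaller
-- bisection and D > 0 a strictly larger one.  This works for every
-- decomposition.

open import Defs
open import Data.Nat using (ℕ)
open import Data.Nat.Divisibility using (_∣_)
open import Data.Fin.Subset using (Subset)
open import Data.Integer using (_<_; 0ℤ)
open import Data.Product using (_×_)
open import Relation.Nullary using (¬_)

open import Data.Nat as ℕ using (zero; suc; _+_)
import Data.Nat.Properties as ℕP
open import Data.Nat.Tactic.RingSolver using (solve-∀)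
open import Data.Nat.ListAction as List using ()
import Data.Integer as ℤ
import Data.Integer.Properties as ℤP
open import Data.Bool using (Bool; true; false; _∧_; _∨_; not; if_then_else_)
open import Data.Fin using (Fin)
import Data.Fin as Fin
open import Data.Fin.Subset using (_∪_; _∩_; ∁; ∣_∣; ⊥)
open import Data.Fin.Subset.Properties using (_∈?_)
open import Data.Vec using ([]; _∷_; lookup)
import Data.Vec.Properties as VecP
open import Data.List using (map; allFin; tabulate)
import Data.List.Properties as LP
open import Data.Product using (_,_; proj₁; proj₂)
open import Relation.Nullary using (does)
open import Relation.Binary.PropositionalEquality
open import Function using (id)
open import Algebra.Properties.CommutativeMonoid.Sum ℕP.+-0-commutativeMonoid
  using (sum-syntax; sum-cong-≗; ∑-distrib-+; ∑-comm)

list-sum≡∑ : ∀ {n} (h : Fin n → ℕ) → List.sum (map h (allFin n)) ≡ ∑[ i < n ] h i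
list-sum≡∑ {n} h = trans (cong List.sum (LP.map-tabulate id h)) (tabulated h)
  where
  tabulated : ∀ {m} (g : Fin m → ℕ) → List.sum (tabulate g) ≡ ∑[ i < m ] g i
  tabulated {zero} g = refl
  tabulated {suc m} g = cong (g Fin.zero +_) (tabulated (λ i → g (Fin.suc i)))

mem≡lookup : ∀ {n} (x : Fin n) (p : Subset n) → does (x ∈? p) ≡ lookup p x
mem≡lookup Fin.zero (true ∷ p) = refl
mem≡lookup Fin.zero (false ∷ p) = refl
mem≡lookup (Fin.suc x) (_ ∷ p) = mem≡lookup x p

lookup-∪ : ∀ {n} (p q : Subset n) x → lookup (p ∪ q) x ≡ lookup p x ∨ lookup q x
lookup-∪ p q x = VecP.lookup-zipWith _∨_ x p q

lookup-∩ : ∀ {n} (p q : Subset n) x → lookup (p ∩ q) x ≡ lookup p x ∧ lookup q x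
lookup-∩ p q x = VecP.lookup-zipWith _∧_ x p q

lookup-∁ : ∀ {n} (p : Subset n) x → lookup (∁ p) x ≡ not (lookup p x)
lookup-∁ p x = VecP.lookup-map x not p

disjoint-at : ∀ {n} {p q : Subset n} → p ∩ q ≡ ⊥ → ∀ x → lookup p x ∧ lookup q x ≡ false
disjoint-at {p = p} {q} p∩q≡⊥ x =
  trans (sym (lookup-∩ p q x)) (trans (cong (λ s → lookup s x) p∩q≡⊥) (VecP.lookup-replicate x false))

subset-ext : ∀ {n} {p q : Subset n} → (∀ x → lookup p x ≡ lookup q x) → p ≡ q
subset-ext {p = p} {q} h =
  trans (sym (VecP.tabulate∘lookup p)) (trans (VecP.tabulate-cong h) (VecP.tabulate∘lookup q))

𝟙 : Bool → ℕ
𝟙 b = if b then 1 else 0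

𝟙-∨ : ∀ a b c → a ∧ b ≡ false → 𝟙 ((a ∨ b) ∧ c) ≡ 𝟙 (a ∧ c) + 𝟙 (b ∧ c)
𝟙-∨ true  true  c ()
𝟙-∨ true  false c _ = sym (ℕP.+-identityʳ (𝟙 c))
𝟙-∨ false b     c _ = refl

module _ {n : ℕ} (G : Graph n) where

  edge-in : Subset n → Subset n → Fin n → Fin n → ℕ
  edge-in X Y x y = 𝟙 (lookup X x ∧ lookup Y y ∧ adj G x y)

  E-as-∑ : ∀ X Y → E G X Y ≡ ∑[ x < n ] ∑[ y < n ] edge-in X Y x y
  E-as-∑ X Y = trans (list-sum≡∑ {n} _) (sum-cong-≗ λ x → trans (list-sum≡∑ {n} _)
    (sum-cong-≗ λ y → cong₂ (λ a b → 𝟙 (a ∧ b ∧ adj G x y)) (mem≡lookup x X) (mem≡lookup y Y)))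

  E-sym : ∀ X Y → E G X Y ≡ E G Y X
  E-sym X Y = begin
    E G X Y                                    ≡⟨ E-as-∑ X Y ⟩
    ∑[ x < n ] ∑[ y < n ] edge-in X Y x y      ≡⟨ ∑-comm (edge-in X Y) ⟩
    ∑[ y < n ] ∑[ x < n ] edge-in X Y x y      ≡⟨ sum-cong-≗ (λ y → sum-cong-≗ (λ x → swap-pair x y)) ⟩
    ∑[ y < n ] ∑[ x < n ] edge-in Y X y x      ≡⟨ E-as-∑ Y X ⟨
    E G Y X                                    ∎
    where
    open ≡-Reasoning
    swap-pair : ∀ x y → edge-in X Y x y ≡ edge-in Y X y x
    swap-pair x y rewrite symm G x y with lookup X x | lookup Y y
    ... | true  | true  = refl
    ... | true  | false = refl
    ... | false | true  = refl
    ... | false | false = refl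

  E-∪ˡ : ∀ {X Y} Z → X ∩ Y ≡ ⊥ → E G (X ∪ Y) Z ≡ E G X Z + E G Y Z
  E-∪ˡ {X} {Y} Z X∩Y≡⊥ = begin
    E G (X ∪ Y) Z                                          ≡⟨ E-as-∑ (X ∪ Y) Z ⟩
    ∑[ x < n ] ∑[ z < n ] edge-in (X ∪ Y) Z x z            ≡⟨ sum-cong-≗ (λ x → sum-cong-≗ (split x)) ⟩
    ∑[ x < n ] ∑[ z < n ] (edge-in X Z x z + edge-in Y Z x z)
      ≡⟨ sum-cong-≗ (λ x → ∑-distrib-+ (edge-in X Z x) (edge-in Y Z x)) ⟩
    ∑[ x < n ] (∑[ z < n ] edge-in X Z x z + ∑[ z < n ] edge-in Y Z x z)
      ≡⟨ ∑-distrib-+ (λ x → ∑[ z < n ] edge-in X Z x z) (λ x → ∑[ z < n ] edge-in Y Z x z) ⟩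
    ∑[ x < n ] ∑[ z < n ] edge-in X Z x z + ∑[ x < n ] ∑[ z < n ] edge-in Y Z x z
      ≡⟨ cong₂ _+_ (E-as-∑ X Z) (E-as-∑ Y Z) ⟨
    E G X Z + E G Y Z                                      ∎
    where
    open ≡-Reasoning
    split : ∀ x z → edge-in (X ∪ Y) Z x z ≡ edge-in X Z x z + edge-in Y Z x z
    split x z = trans (cong (λ b → 𝟙 (b ∧ lookup Z z ∧ adj G x z)) (lookup-∪ X Y x))
                      (𝟙-∨ (lookup X x) (lookup Y x) _ (disjoint-at X∩Y≡⊥ x))

  E-∪ʳ : ∀ X {Y Z} → Y ∩ Z ≡ ⊥ → E G X (Y ∪ Z) ≡ E G X Y + E G X Z
  E-∪ʳ X {Y} {Z} Y∩Z≡⊥ = begin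
    E G X (Y ∪ Z)      ≡⟨ E-sym X (Y ∪ Z) ⟩
    E G (Y ∪ Z) X      ≡⟨ E-∪ˡ X Y∩Z≡⊥ ⟩
    E G Y X + E G Z X  ≡⟨ cong₂ _+_ (E-sym Y X) (E-sym Z X) ⟩
    E G X Y + E G X Z  ∎
    where open ≡-Reasoning

-- A point of a decomposed bisection lies in exactly one of A₁, A₂, B₁, B₂;
-- consequently it lies in exactly one of A₁ ∪ B₁ and A₂ ∪ B₂.
exchange-at : ∀ a₁ a₂ b₁ b₂ → a₁ ∧ a₂ ≡ false → b₁ ∧ b₂ ≡ false →
  b₁ ∨ b₂ ≡ not (a₁ ∨ a₂) →
  (a₁ ∧ b₁ ≡ false) × (a₂ ∧ b₂ ≡ false) × (not (a₁ ∨ b₁) ≡ a₂ ∨ b₂)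
exchange-at true  true  _     _     ()  _  _
exchange-at true  false false false _   _  _  = refl , refl , refl
exchange-at true  false true  _     _   _  ()
exchange-at true  false false true  _   _  ()
exchange-at false true  false false _   _  _  = refl , refl , refl
exchange-at false true  true  _     _   _  ()
exchange-at false true  false true  _   _  ()
exchange-at false false true  true  _   () _
exchange-at false false true  false _   _  _  = refl , refl , refl
exchange-at false false false true  _   _  _  = refl , refl , refl
exchange-at false false false false _   _  ()

∣∪∣-disjoint : ∀ {n} (p q : Subset n) → p ∩ q ≡ ⊥ → ∣ p ∪ q ∣ ≡ ∣ p ∣ + ∣ q ∣
∣∪∣-disjoint []          []          _    = refl
∣∪∣-disjoint (true  ∷ p) (true  ∷ q) ()
∣∪∣-disjoint (true  ∷ p) (false ∷ q) p∩q≡⊥ = cong suc (∣∪∣-disjoint p q (VecP.∷-injectiveʳ p∩q≡⊥))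
∣∪∣-disjoint (false ∷ p) (true  ∷ q) p∩q≡⊥ =
  trans (cong suc (∣∪∣-disjoint p q (VecP.∷-injectiveʳ p∩q≡⊥))) (sym (ℕP.+-suc ∣ p ∣ ∣ q ∣))
∣∪∣-disjoint (false ∷ p) (false ∷ q) p∩q≡⊥ = ∣∪∣-disjoint p q (VecP.∷-injectiveʳ p∩q≡⊥)

module Exchange {n : ℕ} {A A₁ A₂ B₁ B₂ : Subset n}
                (decomposition : IsDecomposition A A₁ A₂ B₁ B₂) where

  private
    halvesA = proj₁ decomposition
    halvesB = proj₂ decomposition

  A₁∩A₂≡⊥ : A₁ ∩ A₂ ≡ ⊥
  A₁∩A₂≡⊥ = proj₁ halvesA

  B₁∩B₂≡⊥ : B₁ ∩ B₂ ≡ ⊥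
  B₁∩B₂≡⊥ = proj₁ halvesB

  A₁∪A₂≡A : A₁ ∪ A₂ ≡ A
  A₁∪A₂≡A = proj₁ (proj₂ halvesA)

  B₁∪B₂≡∁A : B₁ ∪ B₂ ≡ ∁ A
  B₁∪B₂≡∁A = proj₁ (proj₂ halvesB)

  private
    at : ∀ x → (lookup A₁ x ∧ lookup B₁ x ≡ false) × (lookup A₂ x ∧ lookup B₂ x ≡ false) ×
               (not (lookup A₁ x ∨ lookup B₁ x) ≡ lookup A₂ x ∨ lookup B₂ x)
    at x = exchange-at (lookup A₁ x) (lookup A₂ x) (lookup B₁ x) (lookup B₂ x)
      (disjoint-at A₁∩A₂≡⊥ x) (disjoint-at B₁∩B₂≡⊥ x)
      (begin
        lookup B₁ x ∨ lookup B₂ x    ≡⟨ lookup-∪ B₁ B₂ x ⟨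
        lookup (B₁ ∪ B₂) x           ≡⟨ cong (λ s → lookup s x) B₁∪B₂≡∁A ⟩
        lookup (∁ A) x               ≡⟨ lookup-∁ A x ⟩
        not (lookup A x)             ≡⟨ cong (λ s → not (lookup s x)) A₁∪A₂≡A ⟨
        not (lookup (A₁ ∪ A₂) x)     ≡⟨ cong not (lookup-∪ A₁ A₂ x) ⟩
        not (lookup A₁ x ∨ lookup A₂ x) ∎)
      where open ≡-Reasoning

  A₁∩B₁≡⊥ : A₁ ∩ B₁ ≡ ⊥
  A₁∩B₁≡⊥ = subset-ext λ x →
    trans (lookup-∩ A₁ B₁ x) (trans (proj₁ (at x)) (sym (VecP.lookup-replicate x false)))

  A₂∩B₂≡⊥ : A₂ ∩ B₂ ≡ ⊥
  A₂∩B₂≡⊥ = subset-ext λ x →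
    trans (lookup-∩ A₂ B₂ x) (trans (proj₁ (proj₂ (at x))) (sym (VecP.lookup-replicate x false)))

  ∁[A₁∪B₁]≡A₂∪B₂ : ∁ (A₁ ∪ B₁) ≡ A₂ ∪ B₂
  ∁[A₁∪B₁]≡A₂∪B₂ = subset-ext λ x →
    trans (lookup-∁ (A₁ ∪ B₁) x) (trans (cong not (lookup-∪ A₁ B₁ x))
      (trans (proj₂ (proj₂ (at x))) (sym (lookup-∪ A₂ B₂ x))))

  exchanged-bisection : IsBisection (A₁ ∪ B₁)
  exchanged-bisection = begin
    ∣ A₁ ∪ B₁ ∣        ≡⟨ ∣∪∣-disjoint A₁ B₁ A₁∩B₁≡⊥ ⟩
    ∣ A₁ ∣ + ∣ B₁ ∣    ≡⟨ cong₂ _+_ (proj₂ (proj₂ halvesA)) (proj₂ (proj₂ halvesB)) ⟩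
    ∣ A₂ ∣ + ∣ B₂ ∣    ≡⟨ ∣∪∣-disjoint A₂ B₂ A₂∩B₂≡⊥ ⟨
    ∣ A₂ ∪ B₂ ∣        ≡⟨ cong ∣_∣ ∁[A₁∪B₁]≡A₂∪B₂ ⟨
    ∣ ∁ (A₁ ∪ B₁) ∣    ∎
    where open ≡-Reasoning

  cut-before : (G : Graph n) →
    Cut G A ≡ (E G A₁ B₁ + E G A₁ B₂) + (E G A₂ B₁ + E G A₂ B₂)
  cut-before G = begin
    E G A (∁ A)                    ≡⟨ cong₂ (E G) A₁∪A₂≡A B₁∪B₂≡∁A ⟨
    E G (A₁ ∪ A₂) (B₁ ∪ B₂)        ≡⟨ E-∪ˡ G (B₁ ∪ B₂) A₁∩A₂≡⊥ ⟩
    E G A₁ (B₁ ∪ B₂) + E G A₂ (B₁ ∪ B₂)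
      ≡⟨ cong₂ _+_ (E-∪ʳ G A₁ B₁∩B₂≡⊥) (E-∪ʳ G A₂ B₁∩B₂≡⊥) ⟩
    (E G A₁ B₁ + E G A₁ B₂) + (E G A₂ B₁ + E G A₂ B₂) ∎
    where open ≡-Reasoning

  cut-after : (G : Graph n) →
    Cut G (A₁ ∪ B₁) ≡ (E G A₁ A₂ + E G A₁ B₂) + (E G A₂ B₁ + E G B₁ B₂)
  cut-after G = begin
    E G (A₁ ∪ B₁) (∁ (A₁ ∪ B₁))    ≡⟨ cong (E G (A₁ ∪ B₁)) ∁[A₁∪B₁]≡A₂∪B₂ ⟩
    E G (A₁ ∪ B₁) (A₂ ∪ B₂)        ≡⟨ E-∪ˡ G (A₂ ∪ B₂) A₁∩B₁≡⊥ ⟩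
    E G A₁ (A₂ ∪ B₂) + E G B₁ (A₂ ∪ B₂)
      ≡⟨ cong₂ _+_ (E-∪ʳ G A₁ A₂∩B₂≡⊥) (E-∪ʳ G B₁ A₂∩B₂≡⊥) ⟩
    (E G A₁ A₂ + E G A₁ B₂) + (E G B₁ A₂ + E G B₁ B₂)
      ≡⟨ cong (λ t → (E G A₁ A₂ + E G A₁ B₂) + (t + E G B₁ B₂)) (E-sym G B₁ A₂) ⟩
    (E G A₁ A₂ + E G A₁ B₂) + (E G A₂ B₁ + E G B₁ B₂) ∎
    where open ≡-Reasoning

  -- The exchange identity: Cut(A₁ ∪ B₁) − Cut A = D.
  exchange-identity : (G : Graph n) →
    Cut G A + (E G A₁ A₂ + E G B₁ B₂) ≡ Cut G (A₁ ∪ B₁) + (E G A₁ B₁ + E G A₂ B₂)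
  exchange-identity G rewrite cut-before G | cut-after G =
    rearrange (E G A₁ A₂) (E G B₁ B₂) (E G A₁ B₁) (E G A₂ B₂) (E G A₁ B₂) (E G A₂ B₁)
    where
    rearrange : ∀ a b c d e f →
      ((c + e) + (f + d)) + (a + b) ≡ ((a + e) + (f + b)) + (c + d)
    rearrange = solve-∀

i-j<0⇒i<j : ∀ {i j} → i ℤ.- j < 0ℤ → i < j
i-j<0⇒i<j i-j<0 = ℤP.≰⇒> λ j≤i → ℤP.<⇒≱ i-j<0 (ℤP.i≤j⇒0≤j-i j≤i)

0<i-j⇒j<i : ∀ {i j} → 0ℤ < i ℤ.- j → j < i
0<i-j⇒j<i 0<i-j = ℤP.≰⇒> λ i≤j → ℤP.<⇒≱ 0<i-j (ℤP.i≤j⇒i-j≤0 i≤j)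

balance-< : ∀ {u v x y} → u + x ≡ v + y → x ℕ.< y → v ℕ.< u
balance-< {u} {v} {x} {y} u+x≡v+y x<y =
  ℕP.+-cancelʳ-< y v u (subst (ℕ._< u + y) u+x≡v+y (ℕP.+-monoʳ-< u x<y))

module _ {n : ℕ} (G : Graph n) {A A₁ A₂ B₁ B₂ : Subset n}
         (decomposition : IsDecomposition A A₁ A₂ B₁ B₂) where
  open Exchange decomposition

  -- By the exchange identity, the sign of D is the sign of Cut(A₁ ∪ B₁) − Cut A.
  negative-D⇒smaller-cut : DVal G A₁ A₂ B₁ B₂ < 0ℤ → Cut G (A₁ ∪ B₁) ℕ.< Cut G A
  negative-D⇒smaller-cut D<0 =
    balance-< (exchange-identity G) (ℤP.drop‿+<+ (i-j<0⇒i<j D<0))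

  positive-D⇒larger-cut : 0ℤ < DVal G A₁ A₂ B₁ B₂ → Cut G A ℕ.< Cut G (A₁ ∪ B₁)
  positive-D⇒larger-cut 0<D =
    balance-< (sym (exchange-identity G)) (ℤP.drop‿+<+ (0<i-j⇒j<i 0<D))

theorem1 : {n : ℕ} (G : Graph n) → Connected G → 4 ∣ n →
    (A : Subset n) → IsBisection A →
    (A₁ A₂ B₁ B₂ : Subset n) → IsOrganized G A A₁ A₂ B₁ B₂ →
    (DVal G A₁ A₂ B₁ B₂ < 0ℤ → ¬ IsMinCut G A) ×
    (0ℤ < DVal G A₁ A₂ B₁ B₂ → ¬ IsMaxCut G A)
theorem1 G _ _ A _ A₁ A₂ B₁ B₂ (decomposition , _) = not-minimum , not-maximum
  where
  open Exchange decomposition using (exchanged-bisection)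

  not-minimum : DVal G A₁ A₂ B₁ B₂ < 0ℤ → ¬ IsMinCut G A
  not-minimum D<0 (_ , minimum) =
    ℕP.<⇒≱ (negative-D⇒smaller-cut G decomposition D<0) (minimum (A₁ ∪ B₁) exchanged-bisection)

  not-maximum : 0ℤ < DVal G A₁ A₂ B₁ B₂ → ¬ IsMaxCut G A
  not-maximum 0<D (_ , maximum) =
    ℕP.<⇒≱ (positive-D⇒larger-cut G decomposition 0<D) (maximum (A₁ ∪ B₁) exchanged-bisection)
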